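{- Let $s_{\langle 2,1\rangle}\ge 2$ be an integer, let $s_i=2$ for every vertex $i\notin\{\langle 2,1\rangle,\langle 2,2\rangle\}$ of $P_3\times P_2$, and let $s_{\langle 2,2\rangle}>\binom{s_{\langle 2,1\rangle}+4}{\lfloor (s_{\langle 2,1\rangle}+4)/2\rfloor}$. Then the vertex-multiplication $H$ of $P_3\times P_2$ with these multiplicities belongs to $\mathscr{C}_1$.
   Context: $P_3$ has vertices $1,2,3$ and edges $12,23$; $P_2$ has vertices $1,2$ and edge $12$. $P_3\times P_2$ is the cartesian product, with vertices $\langle a,b\rangle$, $\langle a,b\rangle\langle a',b'\rangle$ being an edge iff either $a=a'$ and $bb'$ is an edge of $P_2$, or $aa'$ is an edge of $P_3$ and $b=b'$. For a graph $G$ and positive integers $s_v$ ($v\in V(G)$), the vertex-multiplication replaces each vertex $v$ by an independent set $V_v$ of size $s_v$, with $x\in V_u$, $y\in V_v$ adjacent iff $uv\in E(G)$. For a connected bridgeless graph $X$, $\bar d(X)$ is the minimum diameter of a strong orientation of $X$. $\mathscr{C}_1$ is the class of vertex-multiplications of a connected graph $G$ with all multiplicities $\ge 2$ whose orientation number equals $d(G)+1$, $d(G)$ being the diameter of $G$ (here $d(P_3\times P_2)=3$). -}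

module Defs where

open import Level using (0ℓ)
open import Data.Nat using (ℕ; zero; suc; _≤_)
open import Data.Fin using (Fin; toℕ; zero; suc)
open import Data.Product using (Σ; ∃; _×_; _,_)
open import Data.Sum using (_⊎_)
open import Relation.Nullary using (¬_)
open import Relation.Binary.PropositionalEquality using (_≡_)

record Graph : Set₁ where
  field
    V : Set
    E : V → V → Set
open Graph public

data Walk≤ {V : Set} (R : V → V → Set) : ℕ → V → V → Set where
  stay : ∀ {k x} → Walk≤ R k x x
  step : ∀ {k x y z} → R x y → Walk≤ R k y z → Walk≤ R (suc k) x z

AllWithin : {V : Set} → (V → V → Set) → ℕ → Set
AllWithin R n = ∀ x y → Walk≤ R n x y

IsDiameter : {V : Set} → (V → V → Set) → ℕ → Set
IsDiameter R n = AllWithin R n × (∀ m → AllWithin R m → n ≤ m)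

StronglyConnected : {V : Set} → (V → V → Set) → Set
StronglyConnected R = ∀ x y → ∃ λ k → Walk≤ R k x y

Connected : Graph → Set
Connected G = StronglyConnected (E G)

IsOrientation : (G : Graph) → (V G → V G → Set) → Set
IsOrientation G A =
  (∀ x y → A x y → E G x y) ×
  (∀ x y → E G x y → A x y ⊎ A y x) ×
  (∀ x y → A x y → A y x → ⊥')
  where
    open import Data.Empty using () renaming (⊥ to ⊥')

IsOrientationNumber : Graph → ℕ → Set₁
IsOrientationNumber G n =
  (Σ (V G → V G → Set) λ A → IsOrientation G A × StronglyConnected A × IsDiameter A n) ×
  (∀ (A : V G → V G → Set) → IsOrientation G A → StronglyConnected A →
     ∀ m → IsDiameter A m → n ≤ m)

VertexMult : (G : Graph) → (V G → ℕ) → Graph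
VertexMult G s = record
  { V = Σ (V G) (λ v → Fin (s v))
  ; E = λ { (u , _) (v , _) → E G u v } }

InC1 : (G : Graph) → (V G → ℕ) → Set₁
InC1 G s =
  Connected G × (∀ v → 2 ≤ s v) ×
  (∃ λ d → IsDiameter (E G) d × IsOrientationNumber (VertexMult G s) (suc d))

-- The path P_n on vertices 1..n (Fin n, index i ↦ vertex i+1).
PathGraph : ℕ → Graph
PathGraph n = record
  { V = Fin n
  ; E = λ a b → (suc (toℕ a) ≡ toℕ b) ⊎ (suc (toℕ b) ≡ toℕ a) }

_□_ : Graph → Graph → Graph
G □ H = record
  { V = V G × V H
  ; E = λ { (a , b) (a' , b') → ((a ≡ a') × E H b b') ⊎ (E G a a' × (b ≡ b')) } }

P3×P2 : Graph
P3×P2 = PathGraph 3 □ PathGraph 2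

-- ⟨2,1⟩ and ⟨2,2⟩ (1-based labels; Fin is 0-based).
v21 v22 : Fin 3 × Fin 2
v21 = (suc zero , zero)
v22 = (suc zero , suc zero)

-- Upper bound: the vertex-multiplication of P₃ × P₂ with all multiplicities 2 has an orientation
-- in which any two vertices, equal or not, are joined by a nonempty walk of length at most 4.
-- Collapsing every V_v of H onto two of its vertices pulls this orientation back to one of H of
-- diameter at most 4.
--
-- Lower bound: ⟨2,2⟩ lies on no triangle of P₃ × P₂, so in an orientation of H of diameter at
-- most 3 two copies x, y of ⟨2,2⟩ are joined by a path x → z → y through the neighbourhood N of
-- V_⟨2,2⟩. Hence the out-neighbourhoods of the copies inside N form an antichain: if that of x
-- were contained in that of y, the arc z → y would be reversed. By Sperner's theorem, proved via
-- the LYM inequality, s⟨2,2⟩ ≤ C(|N|, ⌊|N|/2⌋) with |N| = s⟨2,1⟩ + 4.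
module Submission where

open import Defs
open import Data.Nat using (ℕ; zero; suc; _+_; _*_; _∸_; _≤_; _<_; z≤n; s≤s; s≤s⁻¹; _<?_)
open import Data.Nat.Base using (_!; ≢-nonZero⁻¹)
open import Data.Nat.Properties
open import Data.Nat.Combinatorics using (_C_; nCk≡n!/k![n-k]!; k![n∸k]!∣n!)
open import Data.Nat.Divisibility using (∣⇒≤)
open import Data.Nat.DivMod using (_/_; _%_; m≡m%n+[m/n]*n; m%n<n; m/n≤m; m/n*n≡m)
open import Data.Nat.ListAction using (sum)
open import Data.Nat.ListAction.Properties using (sum-++)
open import Data.Bool using (if_then_else_)
open import Data.Fin using (Fin; zero; suc; toℕ; inject≤; splitAt; _↑ˡ_; _↑ʳ_)
open import Data.Fin.Properties using (any?; splitAt-↑ˡ; splitAt-↑ʳ) renaming (_≟_ to _≟ᶠ_)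
open import Data.Fin.Subset using (Subset; Side; inside; outside; _∈_; _⊆_; _⊈_; ∣_∣; Nonempty)
open import Data.Fin.Subset.Properties using (_∈?_; nonempty?; drop-there; drop-∷-⊆; ∣p∣≤n)
open import Data.Vec as Vec using ([]; _∷_; removeAt; here; there)
open import Data.Vec.Properties using (lookup∘tabulate; lookup⇒[]=; []=⇒lookup)
open import Data.List using (List; []; _∷_; [_]; _++_; map; filter; length; tabulate)
open import Data.List.Properties using (map-++; filter-++; length-tabulate)
import Data.List.Membership.Propositional as List
import Data.List.Membership.DecPropositional
open import Data.List.Relation.Unary.All as All using (All; []; _∷_)
import Data.List.Relation.Unary.All.Properties as All
open import Data.List.Relation.Unary.AllPairs using (AllPairs; []; _∷_)
import Data.List.Relation.Unary.AllPairs.Properties as AllPairs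
open import Data.Product using (∃; _×_; _,_; proj₁; proj₂)
open import Data.Product.Properties using (≡-dec)
open import Data.Sum using (_⊎_; inj₁; inj₂; [_,_]′; map₂)
open import Data.Empty using (⊥-elim)
open import Function using (_∘_)
open import Relation.Nullary using (¬_; Dec; yes; no; does; contradiction)
open import Relation.Nullary.Decidable
  using (map′; from-yes; from-no; decidable-stable; ¬?; _⊎-dec_; _×-dec_; _→-dec_)
open import Relation.Binary using (Decidable; DecidableEquality)
open import Relation.Binary.PropositionalEquality
  using (_≡_; _≢_; refl; sym; trans; cong; cong₂; subst; subst₂; module ≡-Reasoning)
open import Algebra.Properties.CommutativeMonoid.Sum +-0-commutativeMonoid
  using (sum-syntax; ∑-distrib-+; sum-cong-≗; sum-replicate-zero)

private
  variable
    n d e : ℕ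
    X : Set
    R : X → X → Set

∑-const : ∀ m c → ∑[ i < m ] c ≡ m * c
∑-const zero    c = refl
∑-const (suc m) c = cong (c +_) (∑-const m c)

∑-mono-≤ : ∀ {m} {f g : Fin m → ℕ} → (∀ i → f i ≤ g i) → ∑[ i < m ] f i ≤ ∑[ i < m ] g i
∑-mono-≤ {zero}  f≤g = z≤n
∑-mono-≤ {suc m} f≤g = +-mono-≤ (f≤g zero) (∑-mono-≤ (λ i → f≤g (suc i)))

Incomparable : Subset n → Subset n → Set
Incomparable p q = p ⊈ q × q ⊈ p

Antichain : List (Subset n) → Set
Antichain = AllPairs Incomparable

⊈⇒Nonempty : {p q : Subset n} → p ⊈ q → Nonempty p
⊈⇒Nonempty {p = p} p⊈q with nonempty? p
... | yes p≠∅ = p≠∅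
... | no  p=∅ = contradiction (λ {x} x∈p → contradiction (x , x∈p) p=∅) p⊈q

removeAt-⊆⁻ : {p q : Subset (suc n)} (i : Fin (suc n)) → i ∈ q →
              removeAt p i ⊆ removeAt q i → p ⊆ q
removeAt-⊆⁻ {p = _ ∷ _} {inside ∷ _} zero here p′⊆q′ = λ { here → here ; (there x∈p) → there (p′⊆q′ x∈p) }
removeAt-⊆⁻ {p = _ ∷ _ ∷ _} {_ ∷ _ ∷ _} (suc i) i∈q p′⊆q′ = λ
  { here        → head-∈ (p′⊆q′ here)
  ; (there x∈p) → there (removeAt-⊆⁻ i (drop-there i∈q) (drop-∷-⊆ p′⊆q′) x∈p)
  }
  where
  head-∈ : ∀ {k m s} {xs : Subset k} {ys : Subset m} → zero ∈ s ∷ xs → zero ∈ s ∷ ys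
  head-∈ here = here

removeAt-incomparable : {p q : Subset (suc n)} (i : Fin (suc n)) → i ∈ p → i ∈ q →
                        Incomparable p q → Incomparable (removeAt p i) (removeAt q i)
removeAt-incomparable i i∈p i∈q (p⊈q , q⊈p) =
  (λ p′⊆q′ → p⊈q (removeAt-⊆⁻ i i∈q p′⊆q′)) , (λ q′⊆p′ → q⊈p (removeAt-⊆⁻ i i∈p q′⊆p′))

∣p∣≡1+∣removeAt∣ : (p : Subset (suc n)) {i : Fin (suc n)} → i ∈ p → ∣ p ∣ ≡ suc ∣ removeAt p i ∣
∣p∣≡1+∣removeAt∣ (inside ∷ _) here = refl
∣p∣≡1+∣removeAt∣ (inside  ∷ p@(_ ∷ _)) (there i∈p) = cong suc (∣p∣≡1+∣removeAt∣ p i∈p)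
∣p∣≡1+∣removeAt∣ (outside ∷ p@(_ ∷ _)) (there i∈p) = ∣p∣≡1+∣removeAt∣ p i∈p

∑-indicator : (p : Subset n) (c : ℕ) → ∑[ i < n ] (if does (i ∈? p) then c else 0) ≡ ∣ p ∣ * c
∑-indicator []            c = refl
∑-indicator (inside  ∷ p) c = cong (c +_) (∑-indicator p c)
∑-indicator (outside ∷ p) c = ∑-indicator p c

weight : Subset n → ℕ
weight {n} p = ∣ p ∣ ! * (n ∸ ∣ p ∣) !

totalWeight : List (Subset n) → ℕ
totalWeight F = sum (map weight F)

totalWeight-++ : (F G : List (Subset n)) → totalWeight (F ++ G) ≡ totalWeight F + totalWeight G
totalWeight-++ F G = trans (cong sum (map-++ weight F G)) (sum-++ (map weight F) (map weight G))

weight≤n! : (p : Subset n) → weight p ≤ n !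
weight≤n! {n} p = ∣⇒≤ {{n !≢0}} (k![n∸k]!∣n! (∣p∣≤n p))

shrink : Fin (suc n) → List (Subset (suc n)) → List (Subset n)
shrink i F = map (λ p → removeAt p i) (filter (i ∈?_) F)

shrink-++ : (i : Fin (suc n)) (F G : List (Subset (suc n))) → shrink i (F ++ G) ≡ shrink i F ++ shrink i G
shrink-++ i F G = trans (cong (map _) (filter-++ (i ∈?_) F G)) (map-++ _ (filter (i ∈?_) F) (filter (i ∈?_) G))

shrink-antichain : (i : Fin (suc n)) {F : List (Subset (suc n))} → Antichain F → Antichain (shrink i F)
shrink-antichain i [] = []
shrink-antichain i {p ∷ F} (p#F ∷ F#) with i ∈? p
... | no  _   = shrink-antichain i F#
... | yes i∈p = All.map⁺ (All.zipWith (λ (i∈q , p#q) → removeAt-incomparable i i∈p i∈q p#q)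
                                       (All.all-filter (i ∈?_) F , All.filter⁺ (i ∈?_) p#F))
              ∷ shrink-antichain i F#

weight≡∑shrink : (p : Subset (suc n)) → Nonempty p → weight p ≡ ∑[ i < suc n ] totalWeight (shrink i [ p ])
weight≡∑shrink {n} p (i , i∈p) = begin
  weight p                                          ≡⟨ cong (λ m → m ! * (suc n ∸ m) !) (∣p∣≡1+∣removeAt∣ p i∈p) ⟩
  suc k ! * (n ∸ k) !                               ≡⟨ *-assoc (suc k) (k !) ((n ∸ k) !) ⟩
  suc k * c                                         ≡⟨ cong (_* c) (∣p∣≡1+∣removeAt∣ p i∈p) ⟨
  ∣ p ∣ * c                                         ≡⟨ ∑-indicator p c ⟨
  ∑[ j < suc n ] (if does (j ∈? p) then c else 0)   ≡⟨ sum-cong-≗ term ⟩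
  ∑[ j < suc n ] totalWeight (shrink j [ p ])       ∎
  where
  open ≡-Reasoning
  k = ∣ removeAt p i ∣
  c = k ! * (n ∸ k) !
  term : ∀ j → (if does (j ∈? p) then c else 0) ≡ totalWeight (shrink j [ p ])
  term j with j ∈? p
  ... | no  _   = refl
  ... | yes j∈p = begin
    c                           ≡⟨ cong (λ m → m ! * (n ∸ m) !) k≡∣removeAt∣ ⟩
    weight (removeAt p j)       ≡⟨ +-identityʳ _ ⟨
    weight (removeAt p j) + 0   ∎
    where
    k≡∣removeAt∣ : k ≡ ∣ removeAt p j ∣
    k≡∣removeAt∣ = suc-injective (trans (sym (∣p∣≡1+∣removeAt∣ p i∈p)) (∣p∣≡1+∣removeAt∣ p j∈p))

totalWeight≡∑shrink : (F : List (Subset (suc n))) → All Nonempty F →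
                      totalWeight F ≡ ∑[ i < suc n ] totalWeight (shrink i F)
totalWeight≡∑shrink {n} []      []          = sym (sum-replicate-zero (suc n))
totalWeight≡∑shrink {n} (p ∷ F) (p≠∅ ∷ F≠∅) = begin
  weight p + totalWeight F
    ≡⟨ cong₂ _+_ (weight≡∑shrink p p≠∅) (totalWeight≡∑shrink F F≠∅) ⟩
  ∑[ i < suc n ] totalWeight (shrink i [ p ]) + ∑[ i < suc n ] totalWeight (shrink i F)
    ≡⟨ ∑-distrib-+ (λ i → totalWeight (shrink i [ p ])) (λ i → totalWeight (shrink i F)) ⟨
  ∑[ i < suc n ] (totalWeight (shrink i [ p ]) + totalWeight (shrink i F))
    ≡⟨ sum-cong-≗ (λ i → sym (trans (cong totalWeight (shrink-++ i [ p ] F))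
                                     (totalWeight-++ (shrink i [ p ]) (shrink i F)))) ⟩
  ∑[ i < suc n ] totalWeight (shrink i (p ∷ F))    ∎
  where open ≡-Reasoning

antichain-nonempty : {p q : Subset n} {F : List (Subset n)} → Antichain (p ∷ q ∷ F) → All Nonempty (p ∷ q ∷ F)
antichain-nonempty ((p#q ∷ p#F) ∷ _) =
  ⊈⇒Nonempty (proj₁ p#q) ∷ All.map (λ p#r → ⊈⇒Nonempty (proj₂ p#r)) (p#q ∷ p#F)

-- The LYM inequality ∑_{p ∈ F} 1 / C(n, ∣p∣) ≤ 1, multiplied by n!.
lym : (F : List (Subset n)) → Antichain F → totalWeight F ≤ n !
lym []       _ = z≤n
lym {n} (p ∷ []) _ = subst (_≤ n !) (sym (+-identityʳ (weight p))) (weight≤n! p)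
lym {zero}  ([] ∷ [] ∷ _) ((p#q ∷ _) ∷ _) = ⊥-elim (proj₁ p#q (λ x∈p → x∈p))
lym {suc n} F@(_ ∷ _ ∷ _) F# = begin
  totalWeight F                              ≡⟨ totalWeight≡∑shrink F (antichain-nonempty F#) ⟩
  ∑[ i < suc n ] totalWeight (shrink i F)    ≤⟨ ∑-mono-≤ (λ i → lym (shrink i F) (shrink-antichain i F#)) ⟩
  ∑[ i < suc n ] (n !)                       ≡⟨ ∑-const (suc n) (n !) ⟩
  suc n !                                    ∎
  where open ≤-Reasoning

!*!-shift : ∀ {k m} → k ≤ m → suc k ! * m ! ≤ k ! * suc m !
!*!-shift {k} {m} k≤m = begin
  (suc k * k !) * m !  ≤⟨ *-monoˡ-≤ (m !) (*-monoˡ-≤ (k !) (s≤s k≤m)) ⟩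
  (suc m * k !) * m !  ≡⟨ cong (_* m !) (*-comm (suc m) (k !)) ⟩
  (k ! * suc m) * m !  ≡⟨ *-assoc (k !) (suc m) (m !) ⟩
  k ! * suc m !        ∎
  where open ≤-Reasoning

!*!-unbalance : ∀ k e b → k + e ≤ suc b → (k + e) ! * b ! ≤ k ! * (e + b) !
!*!-unbalance k zero    b _ = ≤-reflexive (cong (λ m → m ! * b !) (+-identityʳ k))
!*!-unbalance k (suc e) b k+e≤b = begin
  (k + suc e) ! * b !  ≡⟨ cong (λ m → m ! * b !) (+-suc k e) ⟩
  (suc k + e) ! * b !  ≤⟨ !*!-unbalance (suc k) e b (subst (_≤ suc b) (+-suc k e) k+e≤b) ⟩
  suc k ! * (e + b) !  ≤⟨ !*!-shift k≤e+b ⟩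
  k ! * suc (e + b) !  ∎
  where
  open ≤-Reasoning
  k≤e+b : k ≤ e + b
  k≤e+b = ≤-trans (m≤m+n k e) (≤-trans (s≤s⁻¹ (subst (_≤ suc b) (+-suc k e) k+e≤b)) (m≤n+m b e))

!*!-balanced≤ˡ : ∀ {a b c d} → c ≤ a → a ≤ suc b → a + b ≡ c + d → a ! * b ! ≤ c ! * d !
!*!-balanced≤ˡ {b = b} {c} c≤a a≤1+b a+b≡c+d with m≤n⇒∃[o]m+o≡n c≤a
... | e , refl = subst (λ m → (c + e) ! * b ! ≤ c ! * m !) e+b≡d (!*!-unbalance c e b a≤1+b)
  where
  e+b≡d = +-cancelˡ-≡ c _ _ (trans (sym (+-assoc c e b)) a+b≡c+d)

!*!-balanced≤ : ∀ {a b c d} → a ≤ suc b → b ≤ suc a → a + b ≡ c + d → a ! * b ! ≤ c ! * d !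
!*!-balanced≤ {a} {b} {c} {d} a≤1+b b≤1+a a+b≡c+d with ≤-total c a
... | inj₁ c≤a = !*!-balanced≤ˡ c≤a a≤1+b a+b≡c+d
... | inj₂ a≤c = subst₂ _≤_ (*-comm (b !) (a !)) (*-comm (d !) (c !))
                   (!*!-balanced≤ˡ d≤b b≤1+a (trans (+-comm b a) (trans a+b≡c+d (+-comm c d))))
  where
  d≤b : d ≤ b
  d≤b = +-cancelˡ-≤ c d b (subst (_≤ c + b) a+b≡c+d (+-monoˡ-≤ b a≤c))

n/2-balanced : ∀ n → n / 2 ≤ suc (n ∸ n / 2) × n ∸ n / 2 ≤ suc (n / 2)
n/2-balanced n = subst (λ k → m ≤ suc k × k ≤ suc m) (sym n∸m≡r+m)
                   (m≤n⇒m≤1+n (m≤n+m m r) , +-monoˡ-≤ m (s≤s⁻¹ (m%n<n n 2)))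
  where
  m = n / 2
  r = n % 2
  n∸m≡r+m : n ∸ m ≡ r + m
  n∸m≡r+m = begin
    n ∸ m                  ≡⟨ cong (_∸ m) (m≡m%n+[m/n]*n n 2) ⟩
    r + m * 2 ∸ m          ≡⟨ cong (λ k → r + k ∸ m) (*-comm m 2) ⟩
    r + (m + (m + 0)) ∸ m  ≡⟨ cong (λ k → r + (m + k) ∸ m) (+-identityʳ m) ⟩
    r + (m + m) ∸ m        ≡⟨ cong (_∸ m) (+-assoc r m m) ⟨
    r + m + m ∸ m          ≡⟨ m+n∸n≡m (r + m) m ⟩
    r + m                  ∎
    where open ≡-Reasoning

central-weight≤weight : (p : Subset n) → (n / 2) ! * (n ∸ n / 2) ! ≤ weight p
central-weight≤weight {n} p =
  !*!-balanced≤ {c = ∣ p ∣} {d = n ∸ ∣ p ∣} (proj₁ (n/2-balanced n)) (proj₂ (n/2-balanced n)) (trans (m+[n∸m]≡n (m/n≤m n 2)) (sym (m+[n∸m]≡n (∣p∣≤n p))))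

nCk*k![n∸k]!≡n! : ∀ {n k} → k ≤ n → (n C k) * (k ! * (n ∸ k) !) ≡ n !
nCk*k![n∸k]!≡n! {n} {k} k≤n = begin
  (n C k) * w            ≡⟨ cong (_* w) (nCk≡n!/k![n-k]! k≤n) ⟩
  (n ! / w) {{≢0}} * w   ≡⟨ m/n*n≡m {{≢0}} (k![n∸k]!∣n! k≤n) ⟩
  n !                    ∎
  where
  open ≡-Reasoning
  w = k ! * (n ∸ k) !
  ≢0 = k !* (n ∸ k) !≢0

length*≤sum : ∀ {A : Set} (f : A → ℕ) {c} → (∀ x → c ≤ f x) → ∀ xs → length xs * c ≤ sum (map f xs)
length*≤sum f c≤f []       = z≤n
length*≤sum f c≤f (x ∷ xs) = +-mono-≤ (c≤f x) (length*≤sum f c≤f xs)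

sperner : (F : List (Subset n)) → Antichain F → length F ≤ n C (n / 2)
sperner {n} F F# = *-cancelʳ-≤ (length F) (n C (n / 2)) w {{n / 2 !* (n ∸ n / 2) !≢0}} (begin
  length F * w        ≤⟨ length*≤sum weight central-weight≤weight F ⟩
  totalWeight F       ≤⟨ lym F F# ⟩
  n !                 ≡⟨ nCk*k![n∸k]!≡n! (m/n≤m n 2) ⟨
  (n C (n / 2)) * w   ∎)
  where
  open ≤-Reasoning
  w = (n / 2) ! * (n ∸ n / 2) !

sperner-family : ∀ {m} (f : Fin m → Subset n) → (∀ {i j} → i ≢ j → f i ⊈ f j) → m ≤ n C (n / 2)
sperner-family f f-⊈ = subst (_≤ _) (length-tabulate f)
  (sperner (tabulate f) (AllPairs.tabulate⁺ (λ i≢j → f-⊈ i≢j , f-⊈ (λ j≡i → i≢j (sym j≡i)))))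

0<nCk : ∀ {n k} → k ≤ n → 0 < n C k
0<nCk {n} {k} k≤n with n C k | nCk*k![n∸k]!≡n! k≤n
... | zero  | 0≡n! = contradiction (sym 0≡n!) (≢-nonZero⁻¹ (n !) {{n !≢0}})
... | suc _ | _    = s≤s z≤n

Walk≤-weaken : ∀ {x y} → d ≤ e → Walk≤ R d x y → Walk≤ R e x y
Walk≤-weaken _         stay       = stay
Walk≤-weaken (s≤s d≤e) (step r w) = step r (Walk≤-weaken d≤e w)

AllWithin-weaken : d ≤ e → AllWithin R d → AllWithin R e
AllWithin-weaken d≤e within x y = Walk≤-weaken d≤e (within x y)

AllWithin⇒StronglyConnected : AllWithin R d → StronglyConnected R
AllWithin⇒StronglyConnected {d = d} within x y = d , within x y

¬AllWithin⇒< : ¬ AllWithin R d → AllWithin R e → d < e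
¬AllWithin⇒< {d = d} {e = e} ¬within within with d <? e
... | yes d<e = d<e
... | no  d≮e = contradiction (AllWithin-weaken (s≤s⁻¹ (≰⇒> d≮e)) within) ¬within

isDiameter : AllWithin R (suc d) → ¬ AllWithin R d → IsDiameter R (suc d)
isDiameter within ¬within = within , λ _ → ¬AllWithin⇒< ¬within

Searchable : Set → Set₁
Searchable A = ∀ {P : A → Set} → (∀ x → Dec (P x)) → Dec (∃ P)

×-searchable : ∀ {A B} → Searchable A → Searchable B → Searchable (A × B)
×-searchable ∃A? ∃B? P? = map′ (λ (a , b , p) → (a , b) , p) (λ ((a , b) , p) → a , b , p)
                                (∃A? (λ a → ∃B? (λ b → P? (a , b))))

∀? : ∀ {A} {P : A → Set} → Searchable A → (∀ x → Dec (P x)) → Dec (∀ x → P x)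
∀? ∃? P? with ∃? (λ x → ¬? (P? x))
... | yes (x , ¬Px) = no (λ ∀P → ¬Px (∀P x))
... | no  ¬∃¬P      = yes (λ x → decidable-stable (P? x) (λ ¬Px → ¬∃¬P (x , ¬Px)))

module _ {X : Set} {R : X → X → Set} (_≟_ : DecidableEquality X) (∃? : Searchable X) (R? : Decidable R) where

  walk≤? : ∀ k x y → Dec (Walk≤ R k x y)
  walk≤? zero    x y = map′ (λ { refl → stay }) (λ { stay → refl }) (x ≟ y)
  walk≤? (suc k) x y = map′ [ (λ { refl → stay }) , (λ (z , r , w) → step r w) ]′
                            (λ { stay → inj₁ refl ; (step r w) → inj₂ (_ , r , w) })
                            (x ≟ y ⊎-dec ∃? (λ z → R? x z ×-dec walk≤? k z y))

PathGraph-adjacent? : ∀ n → Decidable (E (PathGraph n))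
PathGraph-adjacent? n a b = (suc (toℕ a) ≟ toℕ b) ⊎-dec (suc (toℕ b) ≟ toℕ a)

□-adjacent? : ∀ {G H} → DecidableEquality (V G) → DecidableEquality (V H) →
              Decidable (E G) → Decidable (E H) → Decidable (E (G □ H))
□-adjacent? _≟G_ _≟H_ EG? EH? (a , b) (a′ , b′) = (a ≟G a′ ×-dec EH? b b′) ⊎-dec (EG? a a′ ×-dec b ≟H b′)

VertexMult-adjacent? : ∀ {G s} → Decidable (E G) → Decidable (E (VertexMult G s))
VertexMult-adjacent? E? (u , _) (v , _) = E? u v

module Pullback {G : Graph} {s t : V G → ℕ}
         (π : ∀ {v} → Fin (s v) → Fin (t v)) (ρ : ∀ {v} → Fin (t v) → Fin (s v))
         (π∘ρ : ∀ {v} (i : Fin (t v)) → π {v} (ρ i) ≡ i)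
         (B : V (VertexMult G t) → V (VertexMult G t) → Set) where

  collapse : V (VertexMult G s) → V (VertexMult G t)
  collapse (v , i) = v , π i

  pullback : V (VertexMult G s) → V (VertexMult G s) → Set
  pullback x y = B (collapse x) (collapse y)

  pullback-orientation : IsOrientation (VertexMult G t) B → IsOrientation (VertexMult G s) pullback
  pullback-orientation (arc⇒edge , edge⇒arc , antisym) =
    (λ x y → arc⇒edge (collapse x) (collapse y)) ,
    (λ x y → edge⇒arc (collapse x) (collapse y)) ,
    (λ x y → antisym (collapse x) (collapse y))

  -- The walks must be nonempty because distinct vertices of the multiplication may collapse to
  -- the same vertex.
  pullback-within : ∀ {d} → (∀ x y → ∃ λ z → B x z × Walk≤ B d z y) → AllWithin pullback (suc d)
  pullback-within within⁺ x y = let z , xz , w = within⁺ (collapse x) (collapse y) in lift x y xz w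
    where
    section : V (VertexMult G t) → V (VertexMult G s)
    section (v , i) = v , ρ i
    collapse∘section : ∀ z → collapse (section z) ≡ z
    collapse∘section (v , i) = cong (v ,_) (π∘ρ i)
    lift : ∀ {d} x y {z} → B (collapse x) z → Walk≤ B d z (collapse y) → Walk≤ pullback (suc d) x y
    lift x y xz stay = step xz stay
    lift x y {z} xz (step zz′ w) =
      step (subst (B (collapse x)) (sym (collapse∘section z)) xz)
           (lift (section z) y (subst (λ u → B u _) (sym (collapse∘section z)) zz′) w)

module _ {G : Graph} {s : V G → ℕ} {v : V G}
         (no-loop : ¬ E G v v) (no-triangle : ∀ a b → E G v a → E G a b → ¬ E G b v)
         {N : ℕ} (nb : Fin N → V (VertexMult G s)) (nb-adjacent : ∀ j → E G v (proj₁ (nb j)))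
         (nb-onto : ∀ x → E G v (proj₁ x) → ∃ λ j → nb j ≡ x)
         {A : V (VertexMult G s) → V (VertexMult G s) → Set}
         (orientation : IsOrientation (VertexMult G s) A) where

  private
    arc⇒edge = proj₁ orientation
    edge⇒arc = proj₁ (proj₂ orientation)
    antisym  = proj₂ (proj₂ orientation)

    copy : Fin (s v) → V (VertexMult G s)
    copy i = v , i

    walk≤3⇒two-step : ∀ {i j} → i ≢ j → Walk≤ A 3 (copy i) (copy j) → ∃ λ z → A (copy i) z × A z (copy j)
    walk≤3⇒two-step i≢j stay                            = ⊥-elim (i≢j refl)
    walk≤3⇒two-step _   (step a stay)                   = ⊥-elim (no-loop (arc⇒edge _ _ a))
    walk≤3⇒two-step _   (step a (step b stay))          = _ , a , b
    walk≤3⇒two-step _   (step a (step b (step c stay))) =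
      ⊥-elim (no-triangle _ _ (arc⇒edge _ _ a) (arc⇒edge _ _ b) (arc⇒edge _ _ c))

    side : ∀ {x y} → A x y ⊎ A y x → Side
    side (inj₁ _) = inside
    side (inj₂ _) = outside

    side≡inside : ∀ {x y} → A x y → (d : A x y ⊎ A y x) → side d ≡ inside
    side≡inside _  (inj₁ _)  = refl
    side≡inside xy (inj₂ yx) = ⊥-elim (antisym _ _ xy yx)

    side≡outside : ∀ {x y} → A y x → (d : A x y ⊎ A y x) → side d ≡ outside
    side≡outside yx (inj₁ xy) = ⊥-elim (antisym _ _ xy yx)
    side≡outside _  (inj₂ _)  = refl

    out : Fin (s v) → Subset N
    out i = Vec.tabulate λ j → side (edge⇒arc (copy i) (nb j) (nb-adjacent j))

    arc⇒∈out : ∀ {i j} → A (copy i) (nb j) → j ∈ out i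
    arc⇒∈out {i} {j} a = lookup⇒[]= j (out i)
      (trans (lookup∘tabulate _ j) (side≡inside a (edge⇒arc (copy i) (nb j) (nb-adjacent j))))

    ∈out⇒¬arc : ∀ {i j} → j ∈ out i → ¬ A (nb j) (copy i)
    ∈out⇒¬arc {i} {j} j∈out a = contradiction
      (trans (sym ([]=⇒lookup j∈out)) (trans (lookup∘tabulate _ j) (side≡outside a _))) λ ()

    out-⊈ : AllWithin A 3 → ∀ {i i′} → i ≢ i′ → out i ⊈ out i′
    out-⊈ within {i} {i′} i≢i′ out⊆ with walk≤3⇒two-step i≢i′ (within (copy i) (copy i′))
    ... | z , a , b with nb-onto z (arc⇒edge _ _ a)
    ... | j , refl = ∈out⇒¬arc (out⊆ (arc⇒∈out a)) b

  multiplicity≤central-binomial : AllWithin A 3 → s v ≤ N C (N / 2)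
  multiplicity≤central-binomial within = sperner-family out (out-⊈ within)

Vertex : Set
Vertex = Fin 3 × Fin 2

v11 v12 v31 v32 : Vertex
v11 = zero , zero
v12 = zero , suc zero
v31 = suc (suc zero) , zero
v32 = suc (suc zero) , suc zero

_≟ᵥ_ : DecidableEquality Vertex
_≟ᵥ_ = ≡-dec _≟ᶠ_ _≟ᶠ_

Vertex-searchable : Searchable Vertex
Vertex-searchable = ×-searchable any? any?

adjacent? : Decidable (E P3×P2)
adjacent? = □-adjacent? {PathGraph 3} {PathGraph 2} _≟ᶠ_ _≟ᶠ_ (PathGraph-adjacent? 3) (PathGraph-adjacent? 2)

P3×P2-diameter : IsDiameter (E P3×P2) 3
P3×P2-diameter = isDiameter (from-yes (within? 3)) (from-no (within? 2))
  where
  within? : ∀ d → Dec (AllWithin (E P3×P2) d)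
  within? d = ∀? Vertex-searchable λ x → ∀? Vertex-searchable λ y → walk≤? _≟ᵥ_ Vertex-searchable adjacent? d x y

v22-no-loop : ¬ E P3×P2 v22 v22
v22-no-loop = from-no (adjacent? v22 v22)

v22-no-triangle : ∀ a b → E P3×P2 v22 a → E P3×P2 a b → ¬ E P3×P2 b v22
v22-no-triangle = from-yes (∀? Vertex-searchable λ a → ∀? Vertex-searchable λ b →
  adjacent? v22 a →-dec (adjacent? a b →-dec ¬? (adjacent? b v22)))

v22-neighbours : ∀ u → E P3×P2 v22 u → u ≡ v21 ⊎ u ≡ v12 ⊎ u ≡ v32
v22-neighbours = from-yes (∀? Vertex-searchable λ u →
  adjacent? v22 u →-dec (u ≟ᵥ v21 ⊎-dec u ≟ᵥ v12 ⊎-dec u ≟ᵥ v32))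

Blowup₂ : Graph
Blowup₂ = VertexMult P3×P2 (λ _ → 2)

_⁰ _¹ : Vertex → V Blowup₂
v ⁰ = v , zero
v ¹ = v , suc zero

_≟₂_ : DecidableEquality (V Blowup₂)
_≟₂_ = ≡-dec _≟ᵥ_ _≟ᶠ_

Blowup₂-searchable : Searchable (V Blowup₂)
Blowup₂-searchable = ×-searchable Vertex-searchable any?

arcs : List (V Blowup₂ × V Blowup₂)
arcs =
  (v11 ⁰ , v21 ⁰) ∷ (v11 ⁰ , v21 ¹) ∷
  (v11 ¹ , v12 ⁰) ∷ (v11 ¹ , v12 ¹) ∷ (v11 ¹ , v21 ⁰) ∷
  (v12 ⁰ , v11 ⁰) ∷ (v12 ⁰ , v22 ¹) ∷
  (v12 ¹ , v11 ⁰) ∷ (v12 ¹ , v22 ⁰) ∷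
  (v21 ⁰ , v22 ⁰) ∷ (v21 ⁰ , v31 ⁰) ∷ (v21 ⁰ , v31 ¹) ∷
  (v21 ¹ , v11 ¹) ∷ (v21 ¹ , v31 ¹) ∷
  (v22 ⁰ , v12 ⁰) ∷ (v22 ⁰ , v21 ¹) ∷ (v22 ⁰ , v32 ¹) ∷
  (v22 ¹ , v12 ¹) ∷ (v22 ¹ , v21 ⁰) ∷ (v22 ¹ , v21 ¹) ∷
  (v31 ⁰ , v21 ¹) ∷ (v31 ⁰ , v32 ⁰) ∷
  (v31 ¹ , v32 ⁰) ∷
  (v32 ⁰ , v22 ⁰) ∷ (v32 ⁰ , v22 ¹) ∷
  (v32 ¹ , v22 ¹) ∷ (v32 ¹ , v31 ⁰) ∷ (v32 ¹ , v31 ¹) ∷ []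

Arc : V Blowup₂ → V Blowup₂ → Set
Arc x y = (x , y) List.∈ arcs

Arc? : Decidable Arc
Arc? x y = (x , y) ∈ˡ? arcs
  where open Data.List.Membership.DecPropositional (≡-dec _≟₂_ _≟₂_) using () renaming (_∈?_ to _∈ˡ?_)

Arc-orientation : IsOrientation Blowup₂ Arc
Arc-orientation =
  from-yes (∀₂? λ x y → Arc? x y →-dec adjacent₂? x y) ,
  from-yes (∀₂? λ x y → adjacent₂? x y →-dec (Arc? x y ⊎-dec Arc? y x)) ,
  from-yes (∀₂? λ x y → Arc? x y →-dec (Arc? y x →-dec no λ ()))
  where
  adjacent₂? = VertexMult-adjacent? {P3×P2} adjacent?
  ∀₂? : {P : V Blowup₂ → V Blowup₂ → Set} → Decidable P → Dec (∀ x y → P x y)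
  ∀₂? P? = ∀? Blowup₂-searchable λ x → ∀? Blowup₂-searchable (P? x)

Arc-nonempty-walks≤4 : ∀ x y → ∃ λ z → Arc x z × Walk≤ Arc 3 z y
Arc-nonempty-walks≤4 = from-yes (∀? Blowup₂-searchable λ x → ∀? Blowup₂-searchable λ y →
  Blowup₂-searchable λ z → Arc? x z ×-dec walk≤? _≟₂_ Blowup₂-searchable Arc? 3 z y)

zero-or-one : Fin n → Fin 2
zero-or-one zero    = zero
zero-or-one (suc _) = suc zero

zero-or-one-inject≤ : (i : Fin 2) (2≤n : 2 ≤ n) → zero-or-one (inject≤ i 2≤n) ≡ i
zero-or-one-inject≤ zero       (s≤s (s≤s _)) = refl
zero-or-one-inject≤ (suc zero) (s≤s (s≤s _)) = refl

module _ (s : Vertex → ℕ) (s≡2 : ∀ i → i ≢ v21 → i ≢ v22 → s i ≡ 2) where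

  v22-neighbour⊎ : Fin (s v21) ⊎ Fin (s v12) ⊎ Fin (s v32) → V (VertexMult P3×P2 s)
  v22-neighbour⊎ = [ (v21 ,_) , [ (v12 ,_) , (v32 ,_) ]′ ]′

  v22-neighbour : Fin (s v21 + (s v12 + s v32)) → V (VertexMult P3×P2 s)
  v22-neighbour = v22-neighbour⊎ ∘ map₂ (splitAt (s v12)) ∘ splitAt (s v21)

  v22-neighbour-adjacent : ∀ j → E P3×P2 v22 (proj₁ (v22-neighbour j))
  v22-neighbour-adjacent j = adjacent (map₂ (splitAt (s v12)) (splitAt (s v21) j))
    where
    adjacent : ∀ y → E P3×P2 v22 (proj₁ (v22-neighbour⊎ y))
    adjacent (inj₁ _)        = from-yes (adjacent? v22 v21)
    adjacent (inj₂ (inj₁ _)) = from-yes (adjacent? v22 v12)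
    adjacent (inj₂ (inj₂ _)) = from-yes (adjacent? v22 v32)

  v22-neighbour-onto : ∀ x → E P3×P2 v22 (proj₁ x) → ∃ λ j → v22-neighbour j ≡ x
  v22-neighbour-onto (u , k) v22∼u with v22-neighbours u v22∼u
  ... | inj₁ refl = k ↑ˡ _ , cong (v22-neighbour⊎ ∘ map₂ (splitAt (s v12))) (splitAt-↑ˡ (s v21) k _)
  ... | inj₂ (inj₁ refl) = s v21 ↑ʳ (k ↑ˡ s v32) ,
    trans (cong (v22-neighbour⊎ ∘ map₂ (splitAt (s v12))) (splitAt-↑ʳ (s v21) _ _))
          (cong (v22-neighbour⊎ ∘ inj₂) (splitAt-↑ˡ (s v12) k (s v32)))
  ... | inj₂ (inj₂ refl) = s v21 ↑ʳ (s v12 ↑ʳ k) ,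
    trans (cong (v22-neighbour⊎ ∘ map₂ (splitAt (s v12))) (splitAt-↑ʳ (s v21) _ _))
          (cong (v22-neighbour⊎ ∘ inj₂) (splitAt-↑ʳ (s v12) (s v32) k))

  orientation-within3⇒s22≤ : ∀ {A} → IsOrientation (VertexMult P3×P2 s) A → AllWithin A 3 →
                              s v22 ≤ (s v21 + 4) C ((s v21 + 4) / 2)
  orientation-within3⇒s22≤ orientation within =
    subst (λ d → s v22 ≤ d C (d / 2)) (cong (s v21 +_) (cong₂ _+_ (s≡2 v12 (λ ()) (λ ())) (s≡2 v32 (λ ()) (λ ()))))
      (multiplicity≤central-binomial v22-no-loop v22-no-triangle
        v22-neighbour v22-neighbour-adjacent v22-neighbour-onto orientation within)

  multiplicities≥2 : 2 ≤ s v21 → (s v21 + 4) C ((s v21 + 4) / 2) < s v22 → ∀ v → 2 ≤ s v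
  multiplicities≥2 2≤s21 C<s22 v with v ≟ᵥ v21 | v ≟ᵥ v22
  ... | yes refl | _        = 2≤s21
  ... | no  _    | yes refl = ≤-trans (s≤s (0<nCk (m/n≤m (s v21 + 4) 2))) C<s22
  ... | no v≢v21 | no v≢v22 = ≤-reflexive (sym (s≡2 v v≢v21 v≢v22))

proposition3p7 : (s : Fin 3 × Fin 2 → ℕ) →
    2 ≤ s v21 →
    (∀ i → i ≢ v21 → i ≢ v22 → s i ≡ 2) →
    (s v21 + 4) C ((s v21 + 4) / 2) < s v22 →
    InC1 P3×P2 s
proposition3p7 s 2≤s21 s≡2 C<s22 =
  AllWithin⇒StronglyConnected (proj₁ P3×P2-diameter) , 2≤s , 3 , P3×P2-diameter ,
  (pullback , orientation , AllWithin⇒StronglyConnected within4 , isDiameter within4 (¬within3 orientation)) ,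
  λ _ orientation′ _ _ diameter → ¬AllWithin⇒< (¬within3 orientation′) (proj₁ diameter)
  where
  2≤s = multiplicities≥2 s s≡2 2≤s21 C<s22
  open Pullback zero-or-one (λ {v} i → inject≤ i (2≤s v)) (λ {v} i → zero-or-one-inject≤ i (2≤s v)) Arc
  orientation = pullback-orientation Arc-orientation
  within4 = pullback-within Arc-nonempty-walks≤4
  ¬within3 : ∀ {A} → IsOrientation (VertexMult P3×P2 s) A → ¬ AllWithin A 3
  ¬within3 orientation′ within = <⇒≱ C<s22 (orientation-within3⇒s22≤ s s≡2 orientation′ within)
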